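{- Let $G$ be an infinite connected graph, let $u^*,v^*$ be two distinct nonadjacent vertices of $G$, and let $\tilde F=\{F_j\}_{j\in\mathbb N}$ be a sequence of paths joining $u^*$ and $v^*$ such that for every edge $e^0\in E(G)$ there are $u^0\in e^0$ and $i=i(e^0)\in\mathbb N$ with $u^0\notin\bigcup_{k=1}^\infty V(F_{i+k})$. Then there is a subsequence $\{F_{j_k}\}_{k\in\mathbb N}$ of $\tilde F$ such that: (a) $E(F_{j_l})\cap E(F_{j_k})=\emptyset$ whenever $l\neq k$; (b) if $C$ is a cycle contained in the graph $\bigcup_{k\in\mathbb N}F_{j_k}$ and $k_0:=\min\{k\in\mathbb N: E(C)\cap E(F_{j_k})\neq\emptyset\}$, then $C$ and $F_{j_{k_0}}$ have at least two common edges.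
   Context: Graphs are simple; paths and cycles are finite subgraphs. -}

module Defs where

open import Data.Nat using (ℕ; _≤_; _<_)
open import Data.List using (List; []; _∷_; _++_; take; length; head; last)
open import Data.List.Membership.Propositional using (_∈_)
open import Data.List.Relation.Unary.Unique.Propositional using (Unique)
open import Data.Maybe using (Maybe; just)
open import Data.Product using (Σ; ∃; _×_; _,_)
open import Data.Sum using (_⊎_)
open import Data.Empty using (⊥)
open import Data.Unit using (⊤)
open import Relation.Nullary using (¬_)
open import Relation.Binary.PropositionalEquality using (_≡_)

-- A simple graph: vertex type with a symmetric irreflexive adjacency relation.
-- (Edges are unordered pairs {x,y} with x ~ y; a relation has no multi-edges.)
record Graph : Set₁ where
  field
    V       : Set
    _~_     : V → V → Set
    ~-sym   : ∀ {x y} → x ~ y → y ~ x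
    ~-irref : ∀ x → ¬ (x ~ x)

module _ (G : Graph) where
  open Graph G

  IsWalk : List V → Set
  IsWalk []           = ⊤
  IsWalk (x ∷ [])     = ⊤
  IsWalk (x ∷ y ∷ xs) = (x ~ y) × IsWalk (y ∷ xs)

  IsPath : V → V → List V → Set
  IsPath u v P = IsWalk P × Unique P × head P ≡ just u × last P ≡ just v

  -- a cycle: list v₀ … vₙ₋₁ (n ≥ 3) of distinct vertices, vᵢ ~ vᵢ₊₁ and vₙ₋₁ ~ v₀
  closeUp : List V → List V
  closeUp C = C ++ take 1 C

  IsCycle : List V → Set
  IsCycle C = 3 ≤ length C × Unique C × IsWalk (closeUp C)

  Connected : Set
  Connected = ∀ u v → ∃ λ P → IsPath u v P

  Infinite : Set
  Infinite = ¬ (Σ (List V) λ xs → ∀ v → v ∈ xs)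

ConsecPair : {A : Set} → List A → A → A → Set
ConsecPair []           a b = ⊥
ConsecPair (x ∷ [])     a b = ⊥
ConsecPair (x ∷ y ∷ xs) a b = (x ≡ a × y ≡ b) ⊎ ConsecPair (y ∷ xs) a b

PathEdge : {A : Set} → List A → A → A → Set
PathEdge P a b = ConsecPair P a b ⊎ ConsecPair P b a

CycleEdge : {A : Set} → List A → A → A → Set
CycleEdge C a b = PathEdge (C ++ take 1 C) a b

SameEdge : {A : Set} → A → A → A → A → Set
SameEdge a b c d = (a ≡ c × b ≡ d) ⊎ (a ≡ d × b ≡ c)

CommonEdge : {A : Set} → (A → A → Set) → (A → A → Set) → Set
CommonEdge {A} E₁ E₂ = Σ A λ a → Σ A λ b → E₁ a b × E₂ a b

TwoCommonEdges : {A : Set} → (A → A → Set) → (A → A → Set) → Set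
TwoCommonEdges {A} E₁ E₂ =
  Σ A λ a → Σ A λ b → Σ A λ c → Σ A λ d →
    E₁ a b × E₂ a b × E₁ c d × E₂ c d × ¬ SameEdge a b c d

StrictlyIncreasing : (ℕ → ℕ) → Set
StrictlyIncreasing j = ∀ {l k} → l < k → j l < j k

-- Thin the sequence out so that each chosen path F_{j_l} is "abandoned" by all
-- later chosen paths: every edge of F_{j_l} has an endpoint that no F_{j_k} with
-- k > l visits.  This is possible because a path has finitely many edges, so the
-- hypothesis yields one index beyond which all of them are abandoned, and the
-- next chosen index is taken past it.  Edge-disjointness (a) is then immediate.
-- For (b), let {x,y} be a common edge of C and F_{j_{k₀}} with x abandoned after
-- k₀.  The other edge {x,c} of C at x lies in some F_{j_k}; minimality of k₀
-- excludes k < k₀ and the abandonment of x excludes k > k₀, so {x,c} is a second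
-- common edge of C and F_{j_{k₀}}.
module Submission where

open import Defs
open import Function using (_∘_; id)
open import Data.Nat using (ℕ; zero; suc; _+_; _<_; _≤_; s≤s; _⊔_)
open import Data.Nat.Properties
  using (<-trans; ≤-<-trans; <-cmp; m≤n⇒m<n∨m≡n; m≤m+n; m≤n+m; m≤m⊔n; m≤n⊔m; +-suc; m≤n⇒∃[o]m+o≡n)
open import Data.List using (List; []; _∷_; _++_; _∷ʳ_; take; length; head; last)
open import Data.List.Membership.Propositional using (_∈_; _∉_)
open import Data.List.Membership.Propositional.Properties using (∈-++⁻)
open import Data.List.Relation.Unary.Any using (here; there)
open import Data.List.Relation.Unary.All using (lookup)
open import Data.List.Relation.Unary.AllPairs using (_∷_)
open import Data.List.Relation.Unary.Unique.Propositional using (Unique)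
open import Data.Maybe using (just)
open import Data.Maybe.Properties using (just-injective)
open import Data.Product using (Σ; ∃; _×_; _,_; proj₁; proj₂)
open import Data.Sum using (_⊎_; inj₁; inj₂; [_,_]; swap)
import Data.Sum as Sum
import Data.Product as Product
open import Data.Empty using (⊥; ⊥-elim)
open import Relation.Nullary using (¬_)
open import Relation.Binary.Definitions using (tri<; tri≈; tri>)
open import Relation.Binary.PropositionalEquality using (_≡_; _≢_; refl; sym; subst)

module _ {A : Set} where

  Unique-head∉ : ∀ {x : A} {xs} → Unique (x ∷ xs) → x ∉ xs
  Unique-head∉ (x∉ ∷ _) x∈ = lookup x∉ x∈ refl

  last-∈ : ∀ (xs : List A) {x} → last xs ≡ just x → x ∈ xs
  last-∈ (y ∷ [])     eq = here (sym (just-injective eq))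
  last-∈ (y ∷ z ∷ zs) eq = there (last-∈ (z ∷ zs) eq)

  ∃-last : ∀ (x : A) xs → ∃ λ y → last (x ∷ xs) ≡ just y
  ∃-last x []       = x , refl
  ∃-last x (y ∷ ys) = ∃-last y ys

  ConsecPair-∈ : ∀ {xs : List A} {x y} → ConsecPair xs x y → x ∈ xs × y ∈ xs
  ConsecPair-∈ {_ ∷ _ ∷ _} (inj₁ (refl , refl)) = here refl , there (here refl)
  ConsecPair-∈ {_ ∷ _ ∷ _} (inj₂ p) = Product.map there there (ConsecPair-∈ p)

  PathEdge-∈ : ∀ {xs : List A} {x y} → PathEdge xs x y → x ∈ xs × y ∈ xs
  PathEdge-∈ (inj₁ p) = ConsecPair-∈ p
  PathEdge-∈ (inj₂ p) = Product.swap (ConsecPair-∈ p)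

  ConsecPair-++⁺ˡ : ∀ {xs : List A} ys {x y} → ConsecPair xs x y → ConsecPair (xs ++ ys) x y
  ConsecPair-++⁺ˡ {_ ∷ _ ∷ _} ys (inj₁ eq) = inj₁ eq
  ConsecPair-++⁺ˡ {_ ∷ _ ∷ _} ys (inj₂ p)  = inj₂ (ConsecPair-++⁺ˡ ys p)

  ConsecPair-∷ʳ⁻ : ∀ (xs : List A) {z x y} → ConsecPair (xs ∷ʳ z) x y →
                   ConsecPair xs x y ⊎ (last xs ≡ just x × y ≡ z)
  ConsecPair-∷ʳ⁻ (w ∷ [])     (inj₁ (refl , refl)) = inj₂ (refl , refl)
  ConsecPair-∷ʳ⁻ (w ∷ v ∷ vs) (inj₁ eq) = inj₁ (inj₁ eq)
  ConsecPair-∷ʳ⁻ (w ∷ v ∷ vs) (inj₂ p)  = Sum.map₁ inj₂ (ConsecPair-∷ʳ⁻ (v ∷ vs) p)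

  ConsecPair-last-∷ʳ : ∀ (xs : List A) {x z} → last xs ≡ just x → ConsecPair (xs ∷ʳ z) x z
  ConsecPair-last-∷ʳ (w ∷ [])     eq = inj₁ (just-injective eq , refl)
  ConsecPair-last-∷ʳ (w ∷ v ∷ vs) eq = inj₂ (ConsecPair-last-∷ʳ (v ∷ vs) eq)

  ∈⇒∃-predecessor : ∀ {x : A} y ys → x ∈ ys → ∃ λ c → ConsecPair (y ∷ ys) c x
  ∈⇒∃-predecessor y (w ∷ ws) (here refl) = y , inj₁ (refl , refl)
  ∈⇒∃-predecessor y (w ∷ ws) (there x∈) = Product.map₂ inj₂ (∈⇒∃-predecessor w ws x∈)

  ∈⇒∃-successor-∷ʳ : ∀ {x : A} xs z → x ∈ xs → ∃ λ c → ConsecPair (xs ∷ʳ z) x c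
  ∈⇒∃-successor-∷ʳ (y ∷ [])     z (here refl) = z , inj₁ (refl , refl)
  ∈⇒∃-successor-∷ʳ (y ∷ w ∷ ws) z (here refl) = w , inj₁ (refl , refl)
  ∈⇒∃-successor-∷ʳ (y ∷ w ∷ ws) z (there x∈) = Product.map₂ inj₂ (∈⇒∃-successor-∷ʳ (w ∷ ws) z x∈)

  Unique⇒ConsecPair-head : ∀ {x : A} {xs y} → Unique (x ∷ xs) → ConsecPair (x ∷ xs) x y →
                           head xs ≡ just y
  Unique⇒ConsecPair-head {xs = _ ∷ _} _ (inj₁ (_ , refl)) = refl
  Unique⇒ConsecPair-head {xs = _ ∷ _} u (inj₂ p) = ⊥-elim (Unique-head∉ u (proj₁ (ConsecPair-∈ p)))

  Unique⇒ConsecPair-asym : ∀ {xs : List A} {a b} → Unique xs →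
                           ConsecPair xs a b → ¬ ConsecPair xs b a
  Unique⇒ConsecPair-asym {_ ∷ _ ∷ _} u (inj₁ (refl , refl)) (inj₁ (eq , _)) = Unique-head∉ u (here eq)
  Unique⇒ConsecPair-asym {_ ∷ _ ∷ _} u (inj₁ (refl , refl)) (inj₂ q) = Unique-head∉ u (proj₂ (ConsecPair-∈ q))
  Unique⇒ConsecPair-asym {_ ∷ _ ∷ _} u (inj₂ p) (inj₁ (refl , refl)) = Unique-head∉ u (proj₂ (ConsecPair-∈ p))
  Unique⇒ConsecPair-asym {_ ∷ _ ∷ _} (_ ∷ u) (inj₂ p) (inj₂ q) = Unique⇒ConsecPair-asym u p q

  Unique⇒¬PathEdge-refl : ∀ {xs : List A} {a} → Unique xs → ¬ PathEdge xs a a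
  Unique⇒¬PathEdge-refl u (inj₁ p) = Unique⇒ConsecPair-asym u p p
  Unique⇒¬PathEdge-refl u (inj₂ p) = Unique⇒ConsecPair-asym u p p

  Unique⇒¬ConsecPair-head-last : ∀ {c₀ c₁ c₂ : A} {cs y} → Unique (c₀ ∷ c₁ ∷ c₂ ∷ cs) →
                                 ConsecPair (c₀ ∷ c₁ ∷ c₂ ∷ cs) c₀ y → last (c₂ ∷ cs) ≡ just y → ⊥
  Unique⇒¬ConsecPair-head-last {cs = cs} u@(_ ∷ u′) p last≡y with Unique⇒ConsecPair-head u p
  ... | refl = Unique-head∉ u′ (last-∈ (_ ∷ cs) last≡y)

  closed-ConsecPair-asym : ∀ {C : List A} {a b} → Unique C → 3 ≤ length C →
                           ConsecPair (C ++ take 1 C) a b → ¬ ConsecPair (C ++ take 1 C) b a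
  closed-ConsecPair-asym {C@(c₀ ∷ c₁ ∷ c₂ ∷ cs)} u (s≤s (s≤s (s≤s _))) p q
    with ConsecPair-∷ʳ⁻ C p | ConsecPair-∷ʳ⁻ C q
  ... | inj₁ p′ | inj₁ q′ = Unique⇒ConsecPair-asym u p′ q′
  ... | inj₁ p′ | inj₂ (last≡b , refl) = Unique⇒¬ConsecPair-head-last u p′ last≡b
  ... | inj₂ (last≡a , refl) | inj₁ q′ = Unique⇒¬ConsecPair-head-last u q′ last≡a
  ... | inj₂ (last≡c₀ , refl) | inj₂ (_ , refl) = Unique-head∉ u (last-∈ (c₁ ∷ c₂ ∷ cs) last≡c₀)

  ∈-closed⁻ : ∀ {C : List A} {x} → x ∈ C ++ take 1 C → x ∈ C
  ∈-closed⁻ {C@(_ ∷ _)} x∈ = [ id , (λ { (here refl) → here refl }) ] (∈-++⁻ C x∈)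

  closed-∃-predecessor : ∀ {C : List A} {x} → x ∈ C → ∃ λ c → ConsecPair (C ++ take 1 C) c x
  closed-∃-predecessor {C@(c₀ ∷ cs)} (here refl) =
    let c , last≡c = ∃-last c₀ cs in c , ConsecPair-last-∷ʳ C last≡c
  closed-∃-predecessor {C@(c₀ ∷ cs)} (there x∈) =
    Product.map₂ (ConsecPair-++⁺ˡ (take 1 C)) (∈⇒∃-predecessor c₀ cs x∈)

  closed-∃-successor : ∀ {C : List A} {x} → x ∈ C → ∃ λ c → ConsecPair (C ++ take 1 C) x c
  closed-∃-successor {C@(c₀ ∷ _)} x∈ = ∈⇒∃-successor-∷ʳ C c₀ x∈

  CycleEdge-∃-otherNeighbour : ∀ {C : List A} {a b} → Unique C → 3 ≤ length C →
                               CycleEdge C a b → ∃ λ c → CycleEdge C a c × c ≢ b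
  CycleEdge-∃-otherNeighbour {C} u len (inj₁ ab)
    with closed-∃-predecessor {C} (∈-closed⁻ {C} (proj₁ (ConsecPair-∈ ab)))
  ... | c , ca = c , inj₂ ca , λ { refl → closed-ConsecPair-asym {C} u len ab ca }
  CycleEdge-∃-otherNeighbour {C} u len (inj₂ ba)
    with closed-∃-successor {C} (∈-closed⁻ {C} (proj₂ (ConsecPair-∈ ba)))
  ... | c , ac = c , inj₁ ac , λ { refl → closed-ConsecPair-asym {C} u len ba ac }

AbsentAfter : {A : Set} → (ℕ → List A) → ℕ → A → Set
AbsentAfter P n u = ∀ m → n < m → u ∉ P m

AbandonsEdges : {A : Set} → (ℕ → List A) → Set
AbandonsEdges P = ∀ l {x y} → PathEdge (P l) x y → AbsentAfter P l x ⊎ AbsentAfter P l y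

module _ {A : Set} {P : ℕ → List A} where

  AbsentAfter-mono : ∀ {n n′ u} → n ≤ n′ → AbsentAfter P n u → AbsentAfter P n′ u
  AbsentAfter-mono n≤n′ u∉ m n′<m = u∉ m (≤-<-trans n≤n′ n′<m)

  AbsentAfter-+suc : ∀ {u} i → (∀ k → u ∉ P (i + suc k)) → AbsentAfter P i u
  AbsentAfter-+suc {u} i u∉ m i<m with m≤n⇒∃[o]m+o≡n i<m
  ... | o , refl = subst (λ n → u ∉ P n) (+-suc i o) (u∉ o)

  AbsentAfter-subsequence : ∀ {j : ℕ → ℕ} {l n u} → (∀ k → l < k → n < j k) →
                            AbsentAfter P n u → AbsentAfter (P ∘ j) l u
  AbsentAfter-subsequence n<j u∉ k l<k = u∉ _ (n<j k l<k)

  AbandonsEdges⇒disjoint< : AbandonsEdges P → ∀ {l k} → l < k →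
                            ¬ CommonEdge (PathEdge (P l)) (PathEdge (P k))
  AbandonsEdges⇒disjoint< abandons {l} {k} l<k (a , b , e , e′) =
    [ (λ a∉ → a∉ k l<k (proj₁ (PathEdge-∈ e′))) , (λ b∉ → b∉ k l<k (proj₂ (PathEdge-∈ e′))) ]
      (abandons l e)

  AbandonsEdges⇒edgeDisjoint : AbandonsEdges P → ∀ l k → l ≢ k →
                               ¬ CommonEdge (PathEdge (P l)) (PathEdge (P k))
  AbandonsEdges⇒edgeDisjoint abandons l k l≢k common with <-cmp l k | common
  ... | tri< l<k _ _ | _ = AbandonsEdges⇒disjoint< abandons l<k common
  ... | tri≈ _ l≡k _ | _ = l≢k l≡k
  ... | tri> _ _ k<l | a , b , e , e′ = AbandonsEdges⇒disjoint< abandons k<l (a , b , e′ , e)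

  AbandonsEdges⇒twoCommonEdges : (∀ l → Unique (P l)) → AbandonsEdges P →
    ∀ {C : List A} → Unique C → 3 ≤ length C →
    (∀ a b → CycleEdge C a b → ∃ λ k → PathEdge (P k) a b) →
    ∀ k₀ → CommonEdge (CycleEdge C) (PathEdge (P k₀)) →
    (∀ k → k < k₀ → ¬ CommonEdge (CycleEdge C) (PathEdge (P k))) →
    TwoCommonEdges (CycleEdge C) (PathEdge (P k₀))
  AbandonsEdges⇒twoCommonEdges unique abandons {C} uniqueC len cover k₀ (a , b , ca , pa) minimal =
    [ secondEdgeAt a b ca pa , secondEdgeAt b a (swap ca) (swap pa) ] (abandons k₀ pa)
    where
    secondEdgeAt : ∀ x y → CycleEdge C x y → PathEdge (P k₀) x y → AbsentAfter P k₀ x →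
                   TwoCommonEdges (CycleEdge C) (PathEdge (P k₀))
    secondEdgeAt x y cxy pxy x∉ with CycleEdge-∃-otherNeighbour {C = C} uniqueC len cxy
    ... | c , cxc , c≢y with cover x c cxc
    ... | k , pxc with <-cmp k k₀
    ... | tri< k<k₀ _ _ = ⊥-elim (minimal k k<k₀ (x , c , cxc , pxc))
    ... | tri> _ _ k₀<k = ⊥-elim (x∉ k k₀<k (proj₁ (PathEdge-∈ pxc)))
    ... | tri≈ _ refl _ = x , y , x , c , cxy , pxy , cxc , pxc , distinct
      where
      distinct : ¬ SameEdge x y x c
      distinct (inj₁ (_ , y≡c))    = c≢y (sym y≡c)
      distinct (inj₂ (refl , refl)) = Unique⇒¬PathEdge-refl (unique k₀) pxy

step⇒strictlyIncreasing : ∀ {f : ℕ → ℕ} → (∀ n → f n < f (suc n)) → StrictlyIncreasing f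
step⇒strictlyIncreasing step {k = suc k} (s≤s l≤k) with m≤n⇒m<n∨m≡n l≤k
... | inj₁ l<k  = <-trans (step⇒strictlyIncreasing step l<k) (step k)
... | inj₂ refl = step k

sparse : (ℕ → ℕ) → ℕ → ℕ
sparse b zero    = 0
sparse b (suc l) = suc (sparse b l + b (sparse b l))

sparse-strictlyIncreasing : ∀ b → StrictlyIncreasing (sparse b)
sparse-strictlyIncreasing b = step⇒strictlyIncreasing λ n → s≤s (m≤m+n (sparse b n) _)

sparse-beyond : ∀ b {l} k → l < k → b (sparse b l) < sparse b k
sparse-beyond b {l} k l<k =
  [ <-trans beyondNext ∘ sparse-strictlyIncreasing b
  , (λ 1+l≡k → subst (λ k → b (sparse b l) < sparse b k) 1+l≡k beyondNext)
  ] (m≤n⇒m<n∨m≡n l<k)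
  where
  beyondNext : b (sparse b l) < sparse b (suc l)
  beyondNext = s≤s (m≤n+m (b (sparse b l)) (sparse b l))

module _ (G : Graph) where
  open Graph G

  IsWalk⇒∃-absentBound : {F : ℕ → List V} →
    (∀ x y → x ~ y → ∃ λ n → AbsentAfter F n x ⊎ AbsentAfter F n y) →
    (P : List V) → IsWalk G P →
    ∃ λ n → ∀ {x y} → ConsecPair P x y → AbsentAfter F n x ⊎ AbsentAfter F n y
  IsWalk⇒∃-absentBound edgeBound []      _ = 0 , λ ()
  IsWalk⇒∃-absentBound edgeBound (_ ∷ []) _ = 0 , λ ()
  IsWalk⇒∃-absentBound edgeBound (x ∷ y ∷ P) (x~y , walk)
    with edgeBound x y x~y | IsWalk⇒∃-absentBound edgeBound (y ∷ P) walk
  ... | n , absentₓᵧ | n′ , absentₚ = n ⊔ n′ , λ where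
    (inj₁ (refl , refl)) → Sum.map (AbsentAfter-mono (m≤m⊔n n n′)) (AbsentAfter-mono (m≤m⊔n n n′)) absentₓᵧ
    (inj₂ p) → Sum.map (AbsentAfter-mono (m≤n⊔m n n′)) (AbsentAfter-mono (m≤n⊔m n n′)) (absentₚ p)

lemma3p9 : (G : Graph) → let open Graph G in
    Infinite G → Connected G →
    (u* v* : V) → u* ≢ v* → ¬ (u* ~ v*) →
    (F : ℕ → List V) → (∀ j → IsPath G u* v* (F j)) →
    (∀ x y → x ~ y →
      Σ V λ u⁰ → (u⁰ ≡ x ⊎ u⁰ ≡ y) ×
        Σ ℕ λ i → ∀ k → u⁰ ∉ F (i + suc k)) →
    Σ (ℕ → ℕ) λ j → StrictlyIncreasing j ×
      (∀ l k → l ≢ k → ¬ CommonEdge (PathEdge (F (j l))) (PathEdge (F (j k)))) ×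
      (∀ (C : List V) → IsCycle G C →
        (∀ a b → CycleEdge C a b → ∃ λ k → PathEdge (F (j k)) a b) →
        ∀ k₀ → CommonEdge (CycleEdge C) (PathEdge (F (j k₀))) →
        (∀ k → k < k₀ → ¬ CommonEdge (CycleEdge C) (PathEdge (F (j k)))) →
        TwoCommonEdges (CycleEdge C) (PathEdge (F (j k₀))))
lemma3p9 G _ _ _ _ _ _ F isPath avoided =
  j , sparse-strictlyIncreasing bound , AbandonsEdges⇒edgeDisjoint abandons ,
  λ C (length≥3 , uniqueC , _) →
    AbandonsEdges⇒twoCommonEdges (λ l → proj₁ (proj₂ (isPath (j l)))) abandons uniqueC length≥3
  where
  open Graph G

  edgeBound : ∀ x y → x ~ y → ∃ λ n → AbsentAfter F n x ⊎ AbsentAfter F n y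
  edgeBound x y x~y with avoided x y x~y
  ... | _ , inj₁ refl , i , u∉ = i , inj₁ (AbsentAfter-+suc i u∉)
  ... | _ , inj₂ refl , i , u∉ = i , inj₂ (AbsentAfter-+suc i u∉)

  pathBound : ∀ n → ∃ λ b → ∀ {x y} → ConsecPair (F n) x y → AbsentAfter F b x ⊎ AbsentAfter F b y
  pathBound n = IsWalk⇒∃-absentBound G edgeBound (F n) (proj₁ (isPath n))

  bound : ℕ → ℕ
  bound n = proj₁ (pathBound n)

  j : ℕ → ℕ
  j = sparse bound

  pathEdgeBound : ∀ n {x y} → PathEdge (F n) x y →
                  AbsentAfter F (bound n) x ⊎ AbsentAfter F (bound n) y
  pathEdgeBound n (inj₁ p) = proj₂ (pathBound n) p
  pathEdgeBound n (inj₂ p) = swap (proj₂ (pathBound n) p)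

  abandons : AbandonsEdges (F ∘ j)
  abandons l e = Sum.map (AbsentAfter-subsequence (sparse-beyond bound))
                         (AbsentAfter-subsequence (sparse-beyond bound))
                         (pathEdgeBound (j l) e)
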